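{- For each $p\in\{\frac14,\frac12,\frac34\}$, there exist infinitely many pairwise non-isomorphic $p$-biased functions on $\mathbb{Z}^2$.
   Context: $\mathbb{Z}^2$ is the graph with edges $\{x,x+e_1\}$, $\{x,x+e_2\}$; $\Gamma(x)=\{x\pm e_1,x\pm e_2\}$. A function $f:\mathbb{Z}^2\to\{0,1\}$ with support $X$ is $p$-biased if $|\Gamma(x)\cap X|=4p$ for every $x\in\mathbb{Z}^2$. Two such functions $f,g$ are isomorphic if there is a graph automorphism $\phi$ of $\mathbb{Z}^2$ with $f=g\circ\phi$. -}

module Defs where

open import Data.Bool using (Bool; true; false)
open import Data.Nat using (ℕ; zero; suc)
open import Data.Integer as ℤ using (ℤ; +_)
open import Data.Product using (_×_; _,_; ∃)
open import Data.Sum using (_⊎_)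
open import Data.List using (List; _∷_; []; length; filter)
open import Data.Rational as ℚ using (ℚ)
open import Function.Bundles using (_⤖_; Bijection)
open import Relation.Binary.PropositionalEquality using (_≡_)
open import Relation.Nullary using (¬_)

Point : Set
Point = ℤ × ℤ

e₁ e₂ : Point
e₁ = (+ 1 , + 0)
e₂ = (+ 0 , + 1)

_⊕_ _⊖_ : Point → Point → Point
(a , b) ⊕ (c , d) = (a ℤ.+ c , b ℤ.+ d)
(a , b) ⊖ (c , d) = (a ℤ.- c , b ℤ.- d)

-- Γ(x) = {x ± e₁, x ± e₂}, as a list of its four (distinct) elements
Γ : Point → List Point
Γ x = (x ⊕ e₁) ∷ (x ⊖ e₁) ∷ (x ⊕ e₂) ∷ (x ⊖ e₂) ∷ []

Adj : Point → Point → Set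
Adj x y = y ≡ x ⊕ e₁ ⊎ y ≡ x ⊖ e₁ ⊎ y ≡ x ⊕ e₂ ⊎ y ≡ x ⊖ e₂

-- |Γ(x) ∩ X| where X = supp f = {y | f y ≡ true}
countSupp : (Point → Bool) → List Point → ℕ
countSupp f [] = 0
countSupp f (y ∷ ys) with f y
... | true  = suc (countSupp f ys)
... | false = countSupp f ys

neighbourCount : (Point → Bool) → Point → ℕ
neighbourCount f x = countSupp f (Γ x)

IsBiased : ℚ → (Point → Bool) → Set
IsBiased p f = ∀ x → (ℤ.+ neighbourCount f x) ℚ./ 1 ≡ (ℤ.+ 4 ℚ./ 1) ℚ.* p

record Automorphism : Set where
  field
    φ      : Point ⤖ Point
    preserves : ∀ x y → Adj x y → Adj (Bijection.to φ x) (Bijection.to φ y)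
    reflects  : ∀ x y → Adj (Bijection.to φ x) (Bijection.to φ y) → Adj x y

Isomorphic : (Point → Bool) → (Point → Bool) → Set
Isomorphic f g = ∃ λ (α : Automorphism) → ∀ x → f x ≡ g (Bijection.to (Automorphism.φ α) x)

module Submission where

-- For p ∈ {¼, ½, ¾} we exhibit a sequence f₀, f₁, … of p-biased functions
-- on ℤ², all of the shape
--     f_n (a , b) = op (band (a + b)) (even b xor [M_n ∣ a + b]),   M_n = 4(n+1),
-- where band u says u ≡ 0, 1 (mod 4) and op is a binary Boolean operation.
--
-- Moving from (a , b) to a neighbour changes a + b by ±1, and
-- band (u + 1), band (u - 1) are complementary.  The horizontal and the
-- vertical neighbour on the same side of the anti-diagonal agree in a + b but
-- have b of opposite parity, so together they contribute one row of the truth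
-- table of op; the two sides together count its true entries: 1, 2 or 3 for
-- op = ∧, the second projection and nand.
--
-- A graph automorphism maps every horizontal line onto a
-- straight line (the midpoint of two points at distance two on a line is their
-- only common neighbour).  As f_j is invariant under translation by M_j times
-- any unit vector, f_i ≅ f_j forces f_i (0 , 0) = f_i (M_j , 0), which fails
-- when M_i ∤ M_j.  Since M_j ∤ M_i for i < j and isomorphism is symmetric, the
-- members of the sequence are pairwise non-isomorphic.

open import Defs
open import Data.Bool using (Bool; true; false; not; _∧_; _∨_; _xor_)
open import Data.Bool.Properties using (not-distribˡ-xor)
open import Data.Nat as ℕ using (ℕ; zero; suc; s≤s)
import Data.Nat.Properties as ℕP
open import Data.Nat.Divisibility as ℕD using () renaming (_∣_ to _∣ℕ_)
open import Data.Nat.Tactic.RingSolver using (solve-∀)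
open import Data.Integer as ℤ using (ℤ; +_; _+_; _*_; 0ℤ; 1ℤ; -1ℤ)
import Data.Integer.Properties as ℤP
open import Data.Integer.Divisibility.Signed
  using (_∣_; _∣?_; divides; ∣ᵤ⇒∣; ∣⇒∣ᵤ; ∣-refl; ∣-trans; ∣m∣n⇒∣m+n; ∣m+n∣n⇒∣m; ∣m⇒∣m*n)
open import Data.Integer.DivMod using (_%_; n%d<d; a≡a%n+[a/n]*n) renaming (_/_ to _div_)
open import Data.Rational as ℚ using (ℚ; _/_)
open import Data.Product using (Σ; _×_; _,_; proj₁; proj₂)
open import Data.Sum using (_⊎_; inj₁; inj₂)
open import Data.List using ([]; _∷_; map)
open import Data.Nat.ListAction using (sum)
open import Function using (_∘_)
open import Function.Bundles using (Bijection; mk⇔)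
open import Function.Construct.Symmetry using (⤖-sym)
open import Relation.Nullary using (¬_; does)
open import Relation.Nullary.Decidable using (dec-true; dec-false; does-⇔)
open import Relation.Binary.Definitions using (tri<; tri≈; tri>)
open import Relation.Binary.PropositionalEquality
  using (_≡_; _≢_; refl; sym; trans; cong; cong₂; subst; subst₂; module ≡-Reasoning)
open import Algebra.Properties.AbelianGroup ℤP.+-0-abelianGroup using (∙-cancelˡ)
open import Algebra.Properties.CommutativeSemigroup ℤP.+-commutativeSemigroup
  using (interchange; xy∙z≈xz∙y)

open ≡-Reasoning

multiple : ℕ → ℤ → Bool
multiple m u = does (+ m ∣? u)

multiple-true : ∀ m u → + m ∣ u → multiple m u ≡ true
multiple-true m u = dec-true (+ m ∣? u)

multiple-false : ∀ m u → ¬ (+ m ∣ u) → multiple m u ≡ false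
multiple-false m u = dec-false (+ m ∣? u)

Periodic : ℕ → (ℤ → Bool) → Set
Periodic m g = ∀ u t → + m ∣ t → g (u + t) ≡ g u

multiple-periodic : ∀ m → Periodic m (multiple m)
multiple-periodic m u t m∣t = does-⇔
  (mk⇔ (λ m∣u+t → ∣m+n∣n⇒∣m m∣u+t m∣t) (λ m∣u → ∣m∣n⇒∣m+n m∣u m∣t))
  (+ m ∣? (u + t)) (+ m ∣? u)

periodic-multiple : ∀ {m k g} → m ∣ℕ k → Periodic m g → Periodic k g
periodic-multiple m∣k per u t k∣t = per u t (∣-trans (∣ᵤ⇒∣ m∣k) k∣t)

periodic-shift : ∀ {m g} → Periodic m g → ∀ c → Periodic m (λ u → g (u + c))
periodic-shift {g = g} per c u t m∣t =
  trans (cong g (xy∙z≈xz∙y u t c)) (per (u + c) t m∣t)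

periodic-not : ∀ {m g} → Periodic m g → Periodic m (not ∘ g)
periodic-not per u t m∣t = cong not (per u t m∣t)

periodic-∨ : ∀ {m g h} → Periodic m g → Periodic m h → Periodic m (λ u → g u ∨ h u)
periodic-∨ pg ph u t m∣t = cong₂ _∨_ (pg u t m∣t) (ph u t m∣t)

agreeOnResidues : ∀ {m g h} → Periodic (suc m) g → Periodic (suc m) h →
                  (∀ r → r ℕ.< suc m → g (+ r) ≡ h (+ r)) → ∀ u → g u ≡ h u
agreeOnResidues {m} {g} {h} pg ph check u = begin
  g u          ≡⟨ cong g u≡r+t ⟩
  g (+ r + t)  ≡⟨ pg (+ r) t m∣t ⟩
  g (+ r)      ≡⟨ check r (n%d<d u (+ suc m)) ⟩
  h (+ r)      ≡⟨ sym (ph (+ r) t m∣t) ⟩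
  h (+ r + t)  ≡⟨ cong h (sym u≡r+t) ⟩
  h u          ∎
  where
  r = u % + suc m
  t = (u div + suc m) * + suc m
  u≡r+t : u ≡ + r + t
  u≡r+t = a≡a%n+[a/n]*n u (+ suc m)
  m∣t : + suc m ∣ t
  m∣t = divides (u div + suc m) refl

even : ℤ → Bool
even = multiple 2

band : ℤ → Bool
band u = multiple 4 u ∨ multiple 4 (u + -1ℤ)

band-periodic : Periodic 4 band
band-periodic = periodic-∨ (multiple-periodic 4) (periodic-shift (multiple-periodic 4) -1ℤ)

even-succ : ∀ u → even (u + 1ℤ) ≡ not (even u)
even-succ = agreeOnResidues (periodic-shift (multiple-periodic 2) 1ℤ)
                            (periodic-not (multiple-periodic 2))
  λ { 0 _ → refl ; 1 _ → refl ; (suc (suc _)) (s≤s (s≤s ())) }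

even-pred : ∀ u → even (u + -1ℤ) ≡ not (even u)
even-pred = agreeOnResidues (periodic-shift (multiple-periodic 2) -1ℤ)
                            (periodic-not (multiple-periodic 2))
  λ { 0 _ → refl ; 1 _ → refl ; (suc (suc _)) (s≤s (s≤s ())) }

band-flip : ∀ u → band (u + 1ℤ) ≡ not (band (u + -1ℤ))
band-flip = agreeOnResidues (periodic-shift band-periodic 1ℤ)
                            (periodic-not (periodic-shift band-periodic -1ℤ))
  λ { 0 _ → refl ; 1 _ → refl ; 2 _ → refl ; 3 _ → refl
    ; (suc (suc (suc (suc _)))) (s≤s (s≤s (s≤s (s≤s ())))) }

period : ℕ → ℕ
period n = 4 ℕ.* suc n

family : (Bool → Bool → Bool) → ℕ → Point → Bool
family op n (a , b) = op (band (a + b)) (even b xor multiple (period n) (a + b))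

family-translate : ∀ op n x y a b →
  family op n ((x , y) ⊕ (a , b)) ≡
  op (band ((x + y) + (a + b))) (even (y + b) xor multiple (period n) ((x + y) + (a + b)))
family-translate op n x y a b =
  cong (λ s → op (band s) (even (y + b) xor multiple (period n) s)) (interchange x a y b)

indicator : Bool → ℕ
indicator true  = 1
indicator false = 0

countSupp-sum : ∀ f ys → countSupp f ys ≡ sum (map (indicator ∘ f) ys)
countSupp-sum f []       = refl
countSupp-sum f (y ∷ ys) with f y
... | true  = cong suc (countSupp-sum f ys)
... | false = countSupp-sum f ys

weight : (Bool → Bool → Bool) → Bool → ℕ
weight op s = indicator (op s true) ℕ.+ indicator (op s false)

tableCount : (Bool → Bool → Bool) → ℕ
tableCount op = weight op true ℕ.+ weight op false

row : ∀ op s c X → indicator (op s (c xor X)) ℕ.+ indicator (op s (not c xor X)) ≡ weight op s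
row op s c X = trans (cong (λ t → indicator (op s (c xor X)) ℕ.+ indicator (op s t))
                           (sym (not-distribˡ-xor c X)))
                     (complementary (c xor X))
  where
  complementary : ∀ t → indicator (op s t) ℕ.+ indicator (op s (not t)) ≡ weight op s
  complementary true  = refl
  complementary false = ℕP.+-comm (indicator (op s false)) (indicator (op s true))

rows : ∀ op s → weight op (not s) ℕ.+ weight op s ≡ tableCount op
rows op true  = ℕP.+-comm (weight op false) (weight op true)
rows op false = refl

-- pair the right/up and the left/down neighbours
regroup : ∀ a b c d → a ℕ.+ (b ℕ.+ (c ℕ.+ (d ℕ.+ 0))) ≡ (a ℕ.+ c) ℕ.+ (b ℕ.+ d)
regroup = solve-∀

-- every vertex sees exactly tableCount op vertices of the support: the four
-- neighbour values are rewritten through a + b ± 1 and the parity of b, then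
-- grouped into the rows of band (u + 1) and band (u - 1) = not band (u + 1)
family-neighbourCount : ∀ op n x → neighbourCount (family op n) x ≡ tableCount op
family-neighbourCount op n (x , y) = begin
  neighbourCount (family op n) (x , y)
    ≡⟨ countSupp-sum (family op n) (Γ (x , y)) ⟩
  sum (map (indicator ∘ family op n) (Γ (x , y)))
    ≡⟨ cong₂ ℕ._+_ (cong indicator (at 1ℤ 0ℤ c (cong even (ℤP.+-identityʳ y))))
      (cong₂ ℕ._+_ (cong indicator (at -1ℤ 0ℤ c (cong even (ℤP.+-identityʳ y))))
      (cong₂ ℕ._+_ (cong indicator (at 0ℤ 1ℤ (not c) (even-succ y)))
      (cong (ℕ._+ 0) (cong indicator (at 0ℤ -1ℤ (not c) (even-pred y)))))) ⟩
  indicator (op s₊ (c xor X₊)) ℕ.+ (indicator (op s₋ (c xor X₋)) ℕ.+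
    (indicator (op s₊ (not c xor X₊)) ℕ.+ (indicator (op s₋ (not c xor X₋)) ℕ.+ 0)))
    ≡⟨ regroup (indicator (op s₊ (c xor X₊))) (indicator (op s₋ (c xor X₋)))
               (indicator (op s₊ (not c xor X₊))) (indicator (op s₋ (not c xor X₋))) ⟩
  (indicator (op s₊ (c xor X₊)) ℕ.+ indicator (op s₊ (not c xor X₊))) ℕ.+
    (indicator (op s₋ (c xor X₋)) ℕ.+ indicator (op s₋ (not c xor X₋)))
    ≡⟨ cong₂ ℕ._+_ (row op s₊ c X₊) (row op s₋ c X₋) ⟩
  weight op s₊ ℕ.+ weight op s₋
    ≡⟨ cong (λ s → weight op s ℕ.+ weight op s₋) (band-flip u) ⟩
  weight op (not s₋) ℕ.+ weight op s₋
    ≡⟨ rows op s₋ ⟩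
  tableCount op ∎
  where
  u  = x + y
  c  = even y
  s₊ = band (u + 1ℤ)
  s₋ = band (u + -1ℤ)
  X₊ = multiple (period n) (u + 1ℤ)
  X₋ = multiple (period n) (u + -1ℤ)
  at : ∀ a b e → even (y + b) ≡ e → family op n ((x , y) ⊕ (a , b)) ≡
       op (band (u + (a + b))) (e xor multiple (period n) (u + (a + b)))
  at a b e eq = trans (family-translate op n x y a b)
    (cong (λ e → op (band (u + (a + b))) (e xor multiple (period n) (u + (a + b)))) eq)

family-biased : ∀ op p → (+ tableCount op / 1) ≡ (+ 4 / 1) ℚ.* p →
                ∀ n → IsBiased p (family op n)
family-biased op p count n x = trans (cong (λ k → + k / 1) (family-neighbourCount op n x)) count

-- periods are multiples of 4, so band and the parity are periodic with them too
4∣period : ∀ n → 4 ∣ℕ period n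
4∣period n = ℕD.m∣m*n (suc n)

family-periodic : ∀ op n p a b → + period n ∣ a → + period n ∣ b →
                  family op n (p ⊕ (a , b)) ≡ family op n p
family-periodic op n (x , y) a b M∣a M∣b = begin
  family op n ((x , y) ⊕ (a , b))
    ≡⟨ family-translate op n x y a b ⟩
  op (band (u + (a + b))) (even (y + b) xor multiple (period n) (u + (a + b)))
    ≡⟨ cong₂ op (periodic-multiple (4∣period n) band-periodic u (a + b) M∣a+b)
                (cong₂ _xor_ (periodic-multiple 2∣period (multiple-periodic 2) y b M∣b)
                             (multiple-periodic (period n) u (a + b) M∣a+b)) ⟩
  op (band u) (even y xor multiple (period n) u) ∎
  where
  u = x + y
  M∣a+b : + period n ∣ a + b
  M∣a+b = ∣m∣n⇒∣m+n M∣a M∣b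
  2∣period : 2 ∣ℕ period n
  2∣period = ℕD.∣-trans (ℕD.divides 2 refl) (4∣period n)

origin : Point
origin = (0ℤ , 0ℤ)

family-origin : ∀ op n → family op n origin ≡ op true false
family-origin op n = cong (λ z → op true (true xor z)) (multiple-true (period n) 0ℤ (divides 0ℤ refl))

family-axis : ∀ op n k → 4 ∣ℕ k → ¬ (period n ∣ℕ k) → family op n (+ k , 0ℤ) ≡ op true true
family-axis op n k 4∣k M∤k = begin
  family op n (+ k , 0ℤ)
    ≡⟨ cong (λ s → op (band s) (true xor multiple (period n) s)) (ℤP.+-identityʳ (+ k)) ⟩
  op (band (+ k)) (true xor multiple (period n) (+ k))
    ≡⟨ cong₂ (λ s X → op (s ∨ multiple 4 (+ k + -1ℤ)) (true xor X))
             (multiple-true 4 (+ k) (∣ᵤ⇒∣ 4∣k))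
             (multiple-false (period n) (+ k) (M∤k ∘ ∣⇒∣ᵤ)) ⟩
  op true true ∎

⊕-assoc : ∀ p q r → (p ⊕ q) ⊕ r ≡ p ⊕ (q ⊕ r)
⊕-assoc (a , b) (c , d) (e , f) = cong₂ _,_ (ℤP.+-assoc a c e) (ℤP.+-assoc b d f)

⊕-swap : ∀ p q r → (p ⊕ q) ⊕ r ≡ (p ⊕ r) ⊕ q
⊕-swap (a , b) (c , d) (e , f) = cong₂ _,_ (xy∙z≈xz∙y a c e) (xy∙z≈xz∙y b d f)

⊕-identityʳ : ∀ p → p ⊕ origin ≡ p
⊕-identityʳ (a , b) = cong₂ _,_ (ℤP.+-identityʳ a) (ℤP.+-identityʳ b)

⊕-cancelˡ : ∀ p q r → p ⊕ q ≡ p ⊕ r → q ≡ r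
⊕-cancelˡ (a , b) (c , d) (e , f) eq =
  cong₂ _,_ (∙-cancelˡ a c e (cong proj₁ eq)) (∙-cancelˡ b d f (cong proj₂ eq))

infix 25 _·_
_·_ : ℕ → Point → Point
k · (a , b) = (+ k * a , + k * b)

·-suc : ∀ k v → suc k · v ≡ (k · v) ⊕ v
·-suc k (a , b) = cong₂ _,_ (step a) (step b)
  where
  step : ∀ a → + suc k * a ≡ + k * a + a
  step a = trans (ℤP.suc-* (+ k) a) (ℤP.+-comm a (+ k * a))

·-multiple : ∀ k v → + k ∣ proj₁ (k · v) × + k ∣ proj₂ (k · v)
·-multiple k (a , b) = ∣m⇒∣m*n a ∣-refl , ∣m⇒∣m*n b ∣-refl

advance : ∀ p k v → (p ⊕ k · v) ⊕ v ≡ p ⊕ suc k · v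
advance p k v = trans (⊕-assoc p (k · v) v) (cong (p ⊕_) (sym (·-suc k v)))

origin⊕·e₁ : ∀ k → origin ⊕ (k · e₁) ≡ (+ k , 0ℤ)
origin⊕·e₁ k = cong₂ _,_ (trans (ℤP.+-identityˡ (+ k * 1ℤ)) (ℤP.*-identityʳ (+ k)))
                         (trans (ℤP.+-identityˡ (+ k * 0ℤ)) (ℤP.*-zeroʳ (+ k)))

data Dir : Set where
  R L U D : Dir

vec : Dir → Point
vec R = e₁
vec L = (-1ℤ , 0ℤ)
vec U = e₂
vec D = (0ℤ , -1ℤ)

opp : Dir → Dir
opp R = L
opp L = R
opp U = D
opp D = U

⊕-vec-opp : ∀ p d → (p ⊕ vec d) ⊕ vec (opp d) ≡ p
⊕-vec-opp p d = trans (⊕-assoc p (vec d) (vec (opp d))) (trans (cong (p ⊕_) (cancels d)) (⊕-identityʳ p))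
  where
  cancels : ∀ d → vec d ⊕ vec (opp d) ≡ origin
  cancels R = refl
  cancels L = refl
  cancels U = refl
  cancels D = refl

direction : Point → Dir
direction (+ suc _ , _)        = R
direction (ℤ.-[1+ _ ] , _)     = L
direction (+ zero , + _)       = U
direction (+ zero , ℤ.-[1+ _ ]) = D

direction-vec : ∀ d → direction (vec d) ≡ d
direction-vec R = refl
direction-vec L = refl
direction-vec U = refl
direction-vec D = refl

vec-injective : ∀ d d′ → vec d ≡ vec d′ → d ≡ d′
vec-injective d d′ eq = trans (sym (direction-vec d)) (trans (cong direction eq) (direction-vec d′))

adj→dir : ∀ x y → Adj x y → Σ Dir λ d → y ≡ x ⊕ vec d
adj→dir x y (inj₁ eq)                = R , eq
adj→dir x y (inj₂ (inj₁ eq))         = L , eq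
adj→dir x y (inj₂ (inj₂ (inj₁ eq)))  = U , eq
adj→dir x y (inj₂ (inj₂ (inj₂ eq)))  = D , eq

dir→adj : ∀ x d → Adj x (x ⊕ vec d)
dir→adj x R = inj₁ refl
dir→adj x L = inj₂ (inj₁ refl)
dir→adj x U = inj₂ (inj₂ (inj₁ refl))
dir→adj x D = inj₂ (inj₂ (inj₂ refl))

uniqueCommonNeighbour : ∀ x v → Adj x v → Adj ((x ⊕ e₁) ⊕ e₁) v → v ≡ x ⊕ e₁
uniqueCommonNeighbour x v adj₁ adj₂ with adj→dir x v adj₁ | adj→dir ((x ⊕ e₁) ⊕ e₁) v adj₂
... | d , v≡x+d | d′ , v≡z+d′ = trans v≡x+d (cong (λ e → x ⊕ vec e) d≡R)
  where
  z+d′ : ((x ⊕ e₁) ⊕ e₁) ⊕ vec d′ ≡ x ⊕ (e₁ ⊕ (e₁ ⊕ vec d′))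
  z+d′ = trans (⊕-assoc (x ⊕ e₁) e₁ (vec d′)) (⊕-assoc x e₁ (e₁ ⊕ vec d′))
  vec-d : vec d ≡ e₁ ⊕ (e₁ ⊕ vec d′)
  vec-d = ⊕-cancelˡ x (vec d) (e₁ ⊕ (e₁ ⊕ vec d′)) (trans (sym v≡x+d) (trans v≡z+d′ z+d′))
  rightward : ∀ d′ → direction (e₁ ⊕ (e₁ ⊕ vec d′)) ≡ R
  rightward R = refl
  rightward L = refl
  rightward U = refl
  rightward D = refl
  d≡R : d ≡ R
  d≡R = trans (sym (direction-vec d)) (trans (cong direction vec-d) (rightward d′))

⟪_⟫ : Automorphism → Point → Point
⟪ α ⟫ = Bijection.to (Automorphism.φ α)

module _ (α : Automorphism) where
  open Automorphism α
  private
    to : Point → Point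
    to = ⟪ α ⟫

  -- three consecutive points x, x + e₁, x + 2e₁ are mapped to three consecutive
  -- points of a line: the middle one is the only common neighbour of the outer ones
  collinear : ∀ x d → to (x ⊕ e₁) ≡ to x ⊕ vec d → to ((x ⊕ e₁) ⊕ e₁) ≡ to (x ⊕ e₁) ⊕ vec d
  collinear x d m≡x+d = begin
    to z        ≡⟨ z≡m+d₂ ⟩
    m ⊕ vec d₂  ≡⟨ cong (λ e → m ⊕ vec e) d₂≡d ⟩
    m ⊕ vec d   ∎
    where
    y = x ⊕ e₁
    z = y ⊕ e₁
    m = to y
    z-step : Σ Dir λ d₂ → to z ≡ m ⊕ vec d₂
    z-step = adj→dir m (to z) (preserves y z (dir→adj y R))
    d₂ = proj₁ z-step
    z≡m+d₂ = proj₂ z-step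
    -- w is a common neighbour of to x and to z
    w = to x ⊕ vec d₂
    z+opp≡w : to z ⊕ vec (opp d) ≡ w
    z+opp≡w = begin
      to z ⊕ vec (opp d)                       ≡⟨ cong (_⊕ vec (opp d)) z≡m+d₂ ⟩
      (m ⊕ vec d₂) ⊕ vec (opp d)               ≡⟨ ⊕-swap m (vec d₂) (vec (opp d)) ⟩
      (m ⊕ vec (opp d)) ⊕ vec d₂               ≡⟨ cong (λ q → (q ⊕ vec (opp d)) ⊕ vec d₂) m≡x+d ⟩
      ((to x ⊕ vec d) ⊕ vec (opp d)) ⊕ vec d₂  ≡⟨ cong (_⊕ vec d₂) (⊕-vec-opp (to x) d) ⟩
      w                                        ∎
    -- its preimage v is a common neighbour of x and z, hence v = y and w = m
    v = proj₁ (Bijection.surjective φ w)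
    to-v : to v ≡ w
    to-v = proj₂ (Bijection.surjective φ w) refl
    v≡y : v ≡ y
    v≡y = uniqueCommonNeighbour x v
      (reflects x v (subst (Adj (to x)) (sym to-v) (dir→adj (to x) d₂)))
      (reflects z v (subst (Adj (to z)) (trans z+opp≡w (sym to-v)) (dir→adj (to z) (opp d))))
    d₂≡d : d₂ ≡ d
    d₂≡d = vec-injective d₂ d
      (⊕-cancelˡ (to x) (vec d₂) (vec d) (trans (trans (sym to-v) (cong to v≡y)) m≡x+d))

  straightLine : ∀ x → Σ Dir λ d → ∀ k → to (x ⊕ k · e₁) ≡ to x ⊕ k · vec d
  straightLine x = d , line
    where
    first : Σ Dir λ d → to (x ⊕ e₁) ≡ to x ⊕ vec d
    first = adj→dir (to x) (to (x ⊕ e₁)) (preserves x (x ⊕ e₁) (dir→adj x R))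
    d = proj₁ first
    StepsBy : Point → Set
    StepsBy q = to (q ⊕ e₁) ≡ to q ⊕ vec d
    step : ∀ k → StepsBy (x ⊕ k · e₁)
    step zero    = subst StepsBy (sym (⊕-identityʳ x)) (proj₂ first)
    step (suc k) = subst StepsBy (advance x k e₁) (collinear (x ⊕ k · e₁) d (step k))
    line : ∀ k → to (x ⊕ k · e₁) ≡ to x ⊕ k · vec d
    line zero    = trans (cong to (⊕-identityʳ x)) (sym (⊕-identityʳ (to x)))
    line (suc k) = begin
      to (x ⊕ suc k · e₁)         ≡⟨ cong to (sym (advance x k e₁)) ⟩
      to ((x ⊕ k · e₁) ⊕ e₁)      ≡⟨ step k ⟩
      to (x ⊕ k · e₁) ⊕ vec d     ≡⟨ cong (_⊕ vec d) (line k) ⟩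
      (to x ⊕ k · vec d) ⊕ vec d  ≡⟨ advance (to x) k (vec d) ⟩
      to x ⊕ suc k · vec d        ∎

  preimage : Point → Point
  preimage y = proj₁ (Bijection.surjective φ y)

  to-preimage : ∀ y → to (preimage y) ≡ y
  to-preimage y = proj₂ (Bijection.surjective φ y) refl

  inverse : Automorphism
  inverse = record
    { φ         = ⤖-sym φ
    ; preserves = λ a b adj →
        reflects _ _ (subst₂ Adj (sym (to-preimage a)) (sym (to-preimage b)) adj)
    ; reflects  = λ a b adj → subst₂ Adj (to-preimage a) (to-preimage b) (preserves _ _ adj)
    }

Isomorphic-sym : ∀ {f g} → Isomorphic f g → Isomorphic g f
Isomorphic-sym {f} {g} (α , f≡g∘α) = inverse α , λ y → begin
  g y                          ≡⟨ cong g (sym (to-preimage α y)) ⟩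
  g (⟪ α ⟫ (preimage α y))     ≡⟨ sym (f≡g∘α (preimage α y)) ⟩
  f (preimage α y)             ∎

-- op distinguishes the values at the origin and on the axis
Sensitive : (Bool → Bool → Bool) → Set
Sensitive op = op true false ≢ op true true

-- f_i ≅ f_j transports the period of f_j along the image of the x-axis, which
-- forces f_i (0 , 0) = f_i (M_j , 0); this fails unless M_i divides M_j
family-nonIsomorphic : ∀ op → Sensitive op → ∀ i j → ¬ (period i ∣ℕ period j) →
                       ¬ Isomorphic (family op i) (family op j)
family-nonIsomorphic op sensitive i j M∤ (α , f≡g∘α) = sensitive (begin
  op true false                               ≡⟨ sym (family-origin op i) ⟩
  family op i origin                          ≡⟨ f≡g∘α origin ⟩
  family op j o′                              ≡⟨ sym (family-periodic op j o′ _ _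
                                                    (proj₁ (·-multiple M (vec d)))
                                                    (proj₂ (·-multiple M (vec d)))) ⟩
  family op j (o′ ⊕ M · vec d)                ≡⟨ cong (family op j) (sym (line M)) ⟩
  family op j (⟪ α ⟫ (origin ⊕ M · e₁))       ≡⟨ sym (f≡g∘α (origin ⊕ M · e₁)) ⟩
  family op i (origin ⊕ M · e₁)               ≡⟨ cong (family op i) (origin⊕·e₁ M) ⟩
  family op i (+ M , 0ℤ)                      ≡⟨ family-axis op i M (4∣period j) M∤ ⟩
  op true true                                ∎)
  where
  M  = period j
  o′ = ⟪ α ⟫ origin
  d    = proj₁ (straightLine α origin)
  line = proj₂ (straightLine α origin)

period-∤ : ∀ {i j} → j ℕ.< i → ¬ (period i ∣ℕ period j)
period-∤ j<i M∣ = ℕP.<⇒≱ (ℕP.*-monoʳ-< 4 (s≤s j<i)) (ℕD.∣⇒≤ M∣)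

family-distinct : ∀ op → Sensitive op → ∀ i j → i ≢ j → ¬ Isomorphic (family op i) (family op j)
family-distinct op sensitive i j i≢j with ℕP.<-cmp i j
... | tri< i<j _ _ = family-nonIsomorphic op sensitive j i (period-∤ i<j) ∘ Isomorphic-sym
... | tri≈ _ i≡j _ = λ _ → i≢j i≡j
... | tri> _ _ j<i = family-nonIsomorphic op sensitive i j (period-∤ j<i)

biasedSequence : ∀ op p → Sensitive op → (+ tableCount op / 1) ≡ (+ 4 / 1) ℚ.* p →
    Σ (ℕ → Point → Bool) λ F →
    (∀ i → IsBiased p (F i)) × (∀ i j → i ≢ j → ¬ Isomorphic (F i) (F j))
biasedSequence op p sensitive count = family op , family-biased op p count , family-distinct op sensitive

-- ∧, the second projection and nand have 1, 2 and 3 true entries respectively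
lemma4p7 : (p : ℚ) → (p ≡ + 1 / 4 ⊎ p ≡ + 1 / 2 ⊎ p ≡ + 3 / 4) →
    Σ (ℕ → Point → Bool) λ F →
      (∀ i → IsBiased p (F i)) × (∀ i j → i ≢ j → ¬ Isomorphic (F i) (F j))
lemma4p7 p (inj₁ refl)        = biasedSequence _∧_ p (λ ()) refl
lemma4p7 p (inj₂ (inj₁ refl)) = biasedSequence (λ _ t → t) p (λ ()) refl
lemma4p7 p (inj₂ (inj₂ refl)) = biasedSequence (λ s t → not (s ∧ t)) p (λ ()) refl
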